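{- Let $G$ be a nontrivial ordered additive abelian group. For all integers $h\ge 3$ and $k\ge 3$, \[ hk-h+1 = \min \mathcal{R}_G(h,k) \qquad\text{but}\qquad hk-h+2 \notin \mathcal{R}_G(h,k). \] In particular, $\mathcal{R}_G(h,k)$ is not an interval of consecutive integers.
   Context: An additive abelian group $G$ is ordered with respect to a total order $<$ if $x<y$ implies $x+z<y+z$ for all $x,y,z\in G$. For a nonempty subset $A$ of $G$ and a positive integer $h$, $hA=\{a_1+\cdots+a_h : a_i\in A\}$ (summands not necessarily distinct). $\mathcal{R}_G(h,k)=\{|hA| : A\subseteq G,\ |A|=k\}$. -}

module Defs where

open import Level using (Level; _⊔_; suc)
open import Data.Nat using (ℕ; _<_)
open import Data.Fin using (Fin)
open import Data.Vec using (Vec; lookup; map; foldr)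
open import Data.Product using (Σ; ∃; ∃-syntax; _×_; _,_)
open import Relation.Nullary using (¬_)
open import Relation.Binary.PropositionalEquality using (_≡_)
open import Relation.Binary.Structures using (IsStrictTotalOrder)
open import Algebra.Bundles using (AbelianGroup)

record OrderedAbelianGroup (c ℓ ℓ< : Level) : Set (suc (c ⊔ ℓ ⊔ ℓ<)) where
  field
    abelianGroup : AbelianGroup c ℓ
  open AbelianGroup abelianGroup public
  field
    _<ᴳ_ : Carrier → Carrier → Set ℓ<
    isStrictTotalOrder : IsStrictTotalOrder _≈_ _<ᴳ_
    +-mono-< : ∀ {x y} z → x <ᴳ y → (x ∙ z) <ᴳ (y ∙ z)

module _ {c ℓ ℓ< : Level} (G : OrderedAbelianGroup c ℓ ℓ<) where
  open OrderedAbelianGroup G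

  Nontrivial : Set (c ⊔ ℓ)
  Nontrivial = ∃[ x ] ¬ (x ≈ ε)

  Distinct : {n : ℕ} → Vec Carrier n → Set ℓ
  Distinct {n} v = ∀ (i j : Fin n) → lookup v i ≈ lookup v j → i ≡ j

  sumᴳ : {n : ℕ} → Vec Carrier n → Carrier
  sumᴳ = foldr _ _∙_ ε

  -- x ∈ hA, where the k-element set A is given by a vector of distinct
  -- elements: x is a sum a₁ + ⋯ + a_h of h (not necessarily distinct)
  -- elements of A.
  InSumset : (h : ℕ) {k : ℕ} → Vec Carrier k → Carrier → Set ℓ
  InSumset h {k} A x = Σ (Vec (Fin k) h) λ f → (x ≈ sumᴳ (map (lookup A) f))

  HasSize : (Carrier → Set ℓ) → ℕ → Set (c ⊔ ℓ)
  HasSize P m = Σ (Vec Carrier m) λ v → Distinct v ×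
    (∀ x → (P x → ∃[ i ] (x ≈ lookup v i)) × (∃[ i ] (x ≈ lookup v i) → P x))

  InR : ℕ → ℕ → ℕ → Set (c ⊔ ℓ)
  InR h k m = Σ (Vec Carrier k) λ A → Distinct A × HasSize (InSumset h A) m

IsIntervalℕ : ∀ {p} → (ℕ → Set p) → Set p
IsIntervalℕ S = ∀ a b c → a < b → b < c → S a → S c → S b

module Submission where

-- Sort A as a₀ < a₁ < ⋯ < a_K (k = K + 1).  For consecutive aᵢ < aᵢ₊₁ the sums
-- (h − j)·aᵢ + j·aᵢ₊₁, j = 0 … h, increase strictly, and gluing these segments gives a
-- chain of h·K + 1 elements of hA.  If A is an arithmetic progression then hA lies in a
-- progression of h·K + 1 terms, so |hA| = h·K + 1.  Otherwise some consecutive x < y < z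
-- has x + z ≠ 2y.  If 2y < x + z, the sums x + z + (h − 2)·y and x + 2z + (h − 3)·y fit
-- into the segments from h·y to h·z (this needs h ≥ 3), so |hA| ≥ h·K + 3; the case
-- x + z < 2y is the same construction for the reversed order, read backwards.  Multiples
-- {0, 1, …, K}·g of a positive g attain h·K + 1, and {0, 2, 3, …, K + 1}·g gives a size
-- beyond h·K + 2, so R_G(h, k) is not an interval.

open import Defs
open import Level using (Level; _⊔_)
open import Function using (flip; _∘_)
open import Data.Nat as ℕ using (ℕ; zero; suc; _+_; _*_; _∸_; _≤_; z≤n; s≤s)
import Data.Nat.Properties as ℕₚ
open import Data.Nat.Tactic.RingSolver using (solve-∀)
open import Data.Fin as Fin using (Fin; toℕ; zero; suc)
import Data.Fin.Properties as Finₚ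
open import Data.Vec as Vec using (Vec; []; _∷_; lookup)
import Data.Vec.Properties as Vecₚ
import Data.List.Properties as Listₚ
open import Data.List as List using (List; []; _∷_; length)
open import Data.List.Relation.Unary.Any as Any using (here; there)
import Data.List.Relation.Unary.Any.Properties as Anyₚ
open import Data.List.Relation.Unary.Linked as Linked using (Linked; []; [-]; _∷_)
open import Data.List.Relation.Unary.Linked.Properties using (AllPairs⇒Linked)
open import Data.List.Sort.Base using (module SortingAlgorithm)
import Data.List.Relation.Unary.Unique.Setoid.Properties as Uniqueₛ
import Data.List.Relation.Unary.AllPairs.Properties as AllPairsₚ
open import Data.List.Relation.Unary.AllPairs using ([]; _∷_)
open import Data.List.Membership.Propositional using () renaming (_∈_ to _∈ₚ_)
open import Data.List.Membership.Propositional.Properties using (∈-allFin; ∈-cartesianProductWith⁺)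
import Data.List.Membership.Setoid.Properties as ∈ₛ
import Data.List.Relation.Unary.Unique.DecSetoid.Properties as Uniqueₚ
import Data.Vec.Relation.Unary.Any as VecAny
import Data.Vec.Relation.Unary.Any.Properties as VecAnyₚ
import Data.Vec.Relation.Unary.All.Properties as VecAllₚ
open import Data.Vec.Relation.Unary.AllPairs using ([]; _∷_)
import Data.Vec.Relation.Unary.Unique.Setoid as VecUnique
import Data.Vec.Relation.Unary.Unique.Setoid.Properties as VecUniqueₚ
import Data.Vec.Membership.Propositional.Properties as Vec∈ₚ
open import Data.Product using (∃-syntax; _×_; _,_; proj₁; proj₂; map₂)
open import Data.Sum using (_⊎_; inj₁; inj₂)
open import Data.Empty using (⊥-elim)
open import Relation.Nullary using (¬_; yes; no)
open import Relation.Unary using (Pred)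
open import Relation.Binary using (Rel; tri<; tri≈; tri>; DecSetoid; StrictTotalOrder)
open import Relation.Binary.Structures using (IsStrictTotalOrder)
open import Relation.Binary.PropositionalEquality as ≡ using (_≡_)
import Relation.Binary.Construct.Flip.EqAndOrd as Flip

module _ {a r p} {A : Set a} (_<_ : Rel A r) (P : Pred A p) where

  infixr 5 _∷⟨_⟩_

  data Chain : A → A → ℕ → Set (a ⊔ r ⊔ p) where
    [_]    : ∀ {x} → P x → Chain x x 0
    _∷⟨_⟩_ : ∀ {x y z n} → P x → x < y → Chain y z n → Chain x z (suc n)

module _ {a r p} {A : Set a} {_<_ : Rel A r} {P : Pred A p} where

  infixr 5 _++_

  _++_ : ∀ {x y z m n} → Chain _<_ P x y m → Chain _<_ P y z n → Chain _<_ P x z (m + n)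
  [ _ ]           ++ d = d
  (px ∷⟨ x<y ⟩ c) ++ d = px ∷⟨ x<y ⟩ (c ++ d)

  _∷ʳ⟨_⟩_ : ∀ {x y z n} → Chain _<_ P x y n → y < z → P z → Chain _<_ P x z (suc n)
  [ px ]          ∷ʳ⟨ x<z ⟩ pz = px ∷⟨ x<z ⟩ [ pz ]
  (px ∷⟨ x<y ⟩ c) ∷ʳ⟨ y<z ⟩ pz = px ∷⟨ x<y ⟩ (c ∷ʳ⟨ y<z ⟩ pz)

  reverse : ∀ {x y n} → Chain (flip _<_) P x y n → Chain _<_ P y x n
  reverse [ px ]          = [ px ]
  reverse (px ∷⟨ y<x ⟩ c) = reverse c ∷ʳ⟨ y<x ⟩ px

  cast : ∀ {x y m n} → m ≡ n → Chain _<_ P x y m → Chain _<_ P x y n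
  cast ≡.refl c = c

opposite : ∀ {c ℓ ℓ<} → OrderedAbelianGroup c ℓ ℓ< → OrderedAbelianGroup c ℓ ℓ<
opposite G = record
  { abelianGroup       = abelianGroup
  ; _<ᴳ_               = flip _<ᴳ_
  ; isStrictTotalOrder = Flip.isStrictTotalOrder isStrictTotalOrder
  ; +-mono-<           = +-mono-<
  }
  where open OrderedAbelianGroup G

module OrderedGroup {c ℓ ℓ<} (G : OrderedAbelianGroup c ℓ ℓ<) where

  open OrderedAbelianGroup G
  open IsStrictTotalOrder isStrictTotalOrder using (_≟_; module Eq)
  open IsStrictTotalOrder isStrictTotalOrder public
    using (compare; irrefl; <-respˡ-≈; <-respʳ-≈) renaming (trans to <-trans)
  open import Algebra.Properties.CommutativeSemigroup commutativeSemigroup using (interchange; x∙yz≈y∙xz)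
  open import Algebra.Properties.Group group using (∙-cancelˡ; \\-leftDividesˡ)
  open import Data.List.Relation.Binary.Permutation.Setoid setoid using (_↭_; ↭-sym)
  import Data.List.Relation.Binary.Permutation.Setoid.Properties setoid as ↭ₚ
  open import Data.List.Membership.Setoid setoid public using (_∈_)
  open import Data.List.Relation.Binary.Subset.Setoid setoid public using (_⊆_)
  open import Data.List.Relation.Unary.Unique.Setoid setoid using (Unique)
  open import Algebra.Properties.CommutativeMonoid.Mult commutativeMonoid public
    using (×-homo-+; ×-congˡ) renaming (_×_ to _·_)

  infix 4 _<_

  _<_ : Carrier → Carrier → Set ℓ<
  _<_ = _<ᴳ_

  <-resp₂ : ∀ {x x′ y y′} → x ≈ x′ → y ≈ y′ → x < y → x′ < y′
  <-resp₂ x≈x′ y≈y′ = <-respˡ-≈ x≈x′ ∘ <-respʳ-≈ y≈y′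

  ∙-monoˡ-< : ∀ z {x y} → x < y → z ∙ x < z ∙ y
  ∙-monoˡ-< z x<y = <-resp₂ (comm _ z) (comm _ z) (+-mono-< z x<y)

  positive-element : Nontrivial G → ∃[ g ] ε < g
  positive-element (x , x≉ε) with compare x ε
  ... | tri< x<ε _ _ = x ⁻¹ , <-resp₂ (inverseʳ x) (identityˡ (x ⁻¹)) (+-mono-< (x ⁻¹) x<ε)
  ... | tri≈ _ x≈ε _ = ⊥-elim (x≉ε x≈ε)
  ... | tri> _ _ ε<x = x , ε<x

  ·-<-suc : ∀ {g} → ε < g → ∀ n → n · g < suc n · g
  ·-<-suc {g} ε<g n = <-respˡ-≈ (identityˡ (n · g)) (+-mono-< (n · g) ε<g)

  ·-strictMonoˡ : ∀ {g} → ε < g → ∀ {m n} → m ℕ.< n → m · g < n · g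
  ·-strictMonoˡ {g} ε<g {m} m<n = go (ℕₚ.≤⇒≤′ m<n)
    where
    go : ∀ {n} → suc m ℕ.≤′ n → m · g < n · g
    go (ℕ.≤′-reflexive ≡.refl) = ·-<-suc ε<g m
    go (ℕ.≤′-step {n} m<n)     = <-trans (go m<n) (·-<-suc ε<g n)

  strictMono⇒injective : ∀ {n} {f : Fin n → Carrier} → (∀ {i j} → i Fin.< j → f i < f j) →
                         ∀ i j → f i ≈ f j → i ≡ j
  strictMono⇒injective f-mono i j fi≈fj with Finₚ.<-cmp i j
  ... | tri< i<j _ _ = ⊥-elim (irrefl fi≈fj (f-mono i<j))
  ... | tri≈ _ i≡j _ = i≡j
  ... | tri> _ _ j<i = ⊥-elim (irrefl (sym fi≈fj) (f-mono j<i))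

  module _ {P : Carrier → Set ℓ} {m : ℕ} where

    injection⇒≤size : ∀ {N} (u : Fin N → Carrier) → (∀ i j → u i ≈ u j → i ≡ j) → (∀ i → P (u i)) →
                      HasSize G P m → N ≤ m
    injection⇒≤size {N} u u-injective u∈P (v , _ , enum) =
      ℕₚ.≮⇒≥ λ m<N → let (i , j , i<j , same) = Finₚ.pigeonhole m<N index in
        Finₚ.<⇒≢ i<j (u-injective i j (trans (at i) (trans (reflexive (≡.cong (lookup v) same)) (sym (at j)))))
      where
      index : Fin N → Fin m
      index i = proj₁ (proj₁ (enum (u i)) (u∈P i))
      at : ∀ i → u i ≈ lookup v (index i)
      at i = proj₂ (proj₁ (enum (u i)) (u∈P i))

    cover⇒size≤ : ∀ {N} (w : Fin N → Carrier) → (∀ x → P x → ∃[ i ] x ≈ w i) →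
                  HasSize G P m → m ≤ N
    cover⇒size≤ {N} w covers (v , distinct , enum) =
      ℕₚ.≮⇒≥ λ N<m → let (i , j , i<j , same) = Finₚ.pigeonhole N<m index in
        Finₚ.<⇒≢ i<j (distinct i j (trans (at i) (trans (reflexive (≡.cong w same)) (sym (at j)))))
      where
      covered : ∀ i → ∃[ i′ ] lookup v i ≈ w i′
      covered i = covers (lookup v i) (proj₂ (enum (lookup v i)) (i , refl))
      index : Fin m → Fin N
      index i = proj₁ (covered i)
      at : ∀ i → lookup v i ≈ w (index i)
      at i = proj₂ (covered i)

  module _ {P : Carrier → Set ℓ} where

    points : ∀ {x y n} → Chain _<_ P x y n → Fin (suc n) → Carrier
    points {x} [ _ ]             _        = x
    points {x} (_ ∷⟨ _ ⟩ _)      zero     = x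
    points     (_ ∷⟨ _ ⟩ chain)  (suc i)  = points chain i

    points-∈ : ∀ {x y n} (chain : Chain _<_ P x y n) i → P (points chain i)
    points-∈ [ px ]           _       = px
    points-∈ (px ∷⟨ _ ⟩ _)    zero    = px
    points-∈ (_ ∷⟨ _ ⟩ chain) (suc i) = points-∈ chain i

    points-above : ∀ {w x y n} → w < x → (chain : Chain _<_ P x y n) → ∀ i → w < points chain i
    points-above w<x [ _ ]              _       = w<x
    points-above w<x (_ ∷⟨ _ ⟩ _)       zero    = w<x
    points-above w<x (_ ∷⟨ x<y ⟩ chain) (suc i) = points-above (<-trans w<x x<y) chain i

    points-increasing : ∀ {x y n} (chain : Chain _<_ P x y n) → ∀ {i j} → i Fin.< j → points chain i < points chain j
    points-increasing (_ ∷⟨ x<y ⟩ chain) {zero}  {suc j} _         = points-above x<y chain j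
    points-increasing (_ ∷⟨ _ ⟩ chain)   {suc i} {suc j} (s≤s i<j) = points-increasing chain i<j

    chain⇒<size : ∀ {x y n m} → Chain _<_ P x y n → HasSize G P m → n ℕ.< m
    chain⇒<size chain =
      injection⇒≤size (points chain) (strictMono⇒injective (points-increasing chain)) (points-∈ chain)

    module _ (P-resp : ∀ {x y} → x ≈ y → P x → P y) where

      chain-respˡ : ∀ {x x′ y n} → x ≈ x′ → Chain _<_ P x y (suc n) → Chain _<_ P x′ y (suc n)
      chain-respˡ x≈x′ (px ∷⟨ x<y ⟩ chain) = P-resp x≈x′ px ∷⟨ <-respˡ-≈ x≈x′ x<y ⟩ chain

      chain-respʳ : ∀ {x y y′ n} → y ≈ y′ → Chain _<_ P x y (suc n) → Chain _<_ P x y′ (suc n)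
      chain-respʳ y≈y′ (px ∷⟨ x<y ⟩ [ py ])              = px ∷⟨ <-respʳ-≈ y≈y′ x<y ⟩ [ P-resp y≈y′ py ]
      chain-respʳ y≈y′ (px ∷⟨ x<y ⟩ chain@(_ ∷⟨ _ ⟩ _)) = px ∷⟨ x<y ⟩ chain-respʳ y≈y′ chain

  fromList-unique : ∀ {xs} → Unique xs → VecUnique.Unique setoid (Vec.fromList xs)
  fromList-unique []                = []
  fromList-unique (x≉xs ∷ xs-unique) = VecAllₚ.fromList⁺ x≉xs ∷ fromList-unique xs-unique

  module _ {P : Carrier → Set ℓ} (xs : List Carrier)
           (sound : ∀ {x} → x ∈ xs → P x) (complete : ∀ {x} → P x → x ∈ xs) where

    enumeration⇒hasSize : ∃[ m ] HasSize G P m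
    enumeration⇒hasSize = length ys , v , distinct , λ x → to , from
      where
      decSetoid : DecSetoid c ℓ
      decSetoid = record { isDecEquivalence = Eq.isDecEquivalence }
      ys : List Carrier
      ys = List.deduplicate _≟_ xs
      v : Vec Carrier (length ys)
      v = Vec.fromList ys
      distinct : Distinct G v
      distinct = VecUniqueₚ.lookup-injective setoid (fromList-unique (Uniqueₚ.deduplicate-! decSetoid xs))
      to : ∀ {x} → P x → ∃[ i ] x ≈ lookup v i
      to {x} px = VecAny.index x∈v , VecAnyₚ.lookup-index x∈v
        where
        x∈v : VecAny.Any (x ≈_) v
        x∈v = VecAnyₚ.fromList⁺ (∈ₛ.∈-deduplicate⁺ setoid _≟_ (λ y≈x z≈y → trans z≈y (sym y≈x)) (complete px))
      from : ∀ {x} → ∃[ i ] x ≈ lookup v i → P x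
      from (i , x≈vᵢ) = sound (∈ₛ.∈-deduplicate⁻ setoid _≟_ xs
        (VecAnyₚ.fromList⁻ (VecAny.map (trans x≈vᵢ ∘ reflexive) (Vec∈ₚ.∈-lookup i v))))

  Arithmetic : Carrier → List Carrier → Set (c ⊔ ℓ)
  Arithmetic d = Linked (λ a b → b ≈ a ∙ d)

  data NonArithmetic : List Carrier → Set (c ⊔ ℓ) where
    here  : ∀ {x y z zs} → ¬ x ∙ z ≈ y ∙ y → NonArithmetic (x ∷ y ∷ z ∷ zs)
    there : ∀ {x zs} → NonArithmetic zs → NonArithmetic (x ∷ zs)

  arithmetic-or-nonArithmetic : ∀ xs → (∃[ d ] Arithmetic d xs) ⊎ NonArithmetic xs
  arithmetic-or-nonArithmetic []           = inj₁ (ε , [])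
  arithmetic-or-nonArithmetic (x ∷ [])     = inj₁ (ε , [-])
  arithmetic-or-nonArithmetic (x ∷ y ∷ []) = inj₁ (x ⁻¹ ∙ y , sym (\\-leftDividesˡ x y) ∷ [-])
  arithmetic-or-nonArithmetic (x ∷ y ∷ z ∷ zs) with arithmetic-or-nonArithmetic (y ∷ z ∷ zs)
  ... | inj₂ nonArithmetic = inj₂ (there nonArithmetic)
  ... | inj₁ (d , progression@(z≈y∙d ∷ _)) with x ∙ z ≟ y ∙ y
  ...   | no  xz≉yy = inj₂ (here xz≉yy)
  ...   | yes xz≈yy = inj₁ (d , sym (∙-cancelˡ y (x ∙ d) y y∙x∙d≈yy) ∷ progression)
    where
    y∙x∙d≈yy : y ∙ (x ∙ d) ≈ y ∙ y
    y∙x∙d≈yy = trans (x∙yz≈y∙xz y x d) (trans (∙-cong refl (sym z≈y∙d)) xz≈yy)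

  arithmetic-∈ : ∀ {d x ys e} → Arithmetic d (x ∷ ys) → e ∈ x ∷ ys → ∃[ t ] t ≤ length ys × e ≈ x ∙ t · d
  arithmetic-∈ _ (here e≈x) = 0 , z≤n , trans e≈x (sym (identityʳ _))
  arithmetic-∈ [-] (there ())
  arithmetic-∈ {d} {x} (y≈x∙d ∷ progression) (there e∈) =
    let (t , t≤ , e≈y∙td) = arithmetic-∈ progression e∈ in
    suc t , s≤s t≤ , trans e≈y∙td (trans (∙-cong y≈x∙d refl) (assoc x d (t · d)))

  strictTotalOrder : StrictTotalOrder c ℓ ℓ<
  strictTotalOrder = record { isStrictTotalOrder = isStrictTotalOrder }

  increasing-permutation : ∀ {xs} → Unique xs → ∃[ ys ] Linked _<_ ys × ys ↭ xs
  increasing-permutation {xs} xs-unique =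
    sort xs , Linked.zipWith strict (sort-↗ xs , AllPairs⇒Linked (↭ₚ.Unique-resp-↭ (↭-sym sorted↭xs) xs-unique)) ,
    sorted↭xs
    where
    open import Relation.Binary.Properties.StrictTotalOrder strictTotalOrder using (decTotalOrder)
    open import Data.List.Sort decTotalOrder using (sort; sort-↗; sortingAlgorithm)
    sorted↭xs : sort xs ↭ xs
    sorted↭xs = SortingAlgorithm.sort-↭ₛ sortingAlgorithm xs
    strict : ∀ {x y} → (x < y ⊎ x ≈ y) × ¬ x ≈ y → x < y
    strict (inj₁ x<y , _)   = x<y
    strict (inj₂ x≈y , x≉y) = ⊥-elim (x≉y x≈y)

  module Sumset {k} (A : Vec Carrier k) where

    elements : List Carrier
    elements = List.tabulate (lookup A)

    infix 4 _∈[_]A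

    _∈[_]A : Carrier → ℕ → Set ℓ
    x ∈[ t ]A = InSumset G t A x

    ∈[]A-resp : ∀ {t x y} → x ≈ y → x ∈[ t ]A → y ∈[ t ]A
    ∈[]A-resp x≈y (f , x≈σf) = f , trans (sym x≈y) x≈σf

    ε∈[0]A : ε ∈[ 0 ]A
    ε∈[0]A = [] , refl

    ∈⇒∈[1]A : ∀ {x} → x ∈ elements → x ∈[ 1 ]A
    ∈⇒∈[1]A x∈ = let (j , x≈Aⱼ) = ∈ₛ.∈-tabulate⁻ setoid x∈ in (j ∷ []) , trans x≈Aⱼ (sym (identityʳ _))

    ∙-∈[+]A : ∀ {s t x y} → x ∈[ s ]A → y ∈[ t ]A → x ∙ y ∈[ s + t ]A
    ∙-∈[+]A ([] , x≈ε)      (g , y≈σg) = g , trans (∙-cong x≈ε y≈σg) (identityˡ _)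
    ∙-∈[+]A (i ∷ f , x≈σif) y∈         =
      let (fg , σf∙y≈σfg) = ∙-∈[+]A (f , refl) y∈ in
      (i ∷ fg) , trans (∙-cong x≈σif refl) (trans (assoc _ _ _) (∙-cong refl σf∙y≈σfg))

    ·-∈[]A : ∀ {x} t → x ∈ elements → t · x ∈[ t ]A
    ·-∈[]A zero    _  = ε∈[0]A
    ·-∈[]A (suc t) x∈ = ∙-∈[+]A (∈⇒∈[1]A x∈) (·-∈[]A t x∈)

    words : ∀ t → List (Vec (Fin k) t)
    words zero    = [] ∷ []
    words (suc t) = List.cartesianProductWith _∷_ (List.allFin k) (words t)

    ∈-words : ∀ {t} (f : Vec (Fin k) t) → f ∈ₚ words t
    ∈-words []      = here ≡.refl
    ∈-words (i ∷ f) = ∈-cartesianProductWith⁺ _∷_ (∈-allFin i) (∈-words f)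

    sumset-hasSize : ∀ t → ∃[ m ] HasSize G (_∈[ t ]A) m
    sumset-hasSize t = enumeration⇒hasSize (List.map σ (words t)) sound complete
      where
      σ : Vec (Fin k) t → Carrier
      σ f = sumᴳ G (Vec.map (lookup A) f)
      sound : ∀ {x} → x ∈ List.map σ (words t) → x ∈[ t ]A
      sound = Any.satisfied ∘ Anyₚ.map⁻
      complete : ∀ {x} → x ∈[ t ]A → x ∈ List.map σ (words t)
      complete (f , x≈σf) = Anyₚ.map⁺ (Any.map (λ { ≡.refl → x≈σf }) (∈-words f))

    translated-segment : ∀ {h t p x y c} → x ∈ elements → y ∈ elements → x < y → c ∈[ t ]A → t + p ≡ h →
                         Chain _<_ (_∈[ h ]A) (c ∙ p · x) (c ∙ p · y) p
    translated-segment {p = zero} _ _ _ c∈ ≡.refl = [ ∙-∈[+]A c∈ ε∈[0]A ]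
    translated-segment {t = t} {suc p} {x} {y} {c} x∈ y∈ x<y c∈ ≡.refl =
      chain-respʳ ∈[]A-resp (assoc c y (p · y))
        (∙-∈[+]A c∈ (·-∈[]A (suc p) x∈)
          ∷⟨ <-respʳ-≈ (sym (assoc c y (p · x))) (∙-monoˡ-< c (+-mono-< (p · x) x<y)) ⟩
         translated-segment x∈ y∈ x<y (∙-∈[+]A c∈ (∈⇒∈[1]A y∈)) (ℕₚ.+-assoc t 1 p))

    segment : ∀ {h x y} → x ∈ elements → y ∈ elements → x < y → Chain _<_ (_∈[ h ]A) (h · x) (h · y) h
    segment {zero}  _  _  _   = [ ε∈[0]A ]
    segment {suc h} x∈ y∈ x<y =
      chain-respˡ ∈[]A-resp (identityˡ _) (chain-respʳ ∈[]A-resp (identityˡ _)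
        (translated-segment x∈ y∈ x<y ε∈[0]A ≡.refl))

    increasing⇒chain : ∀ {h x ys} → x ∷ ys ⊆ elements → Linked _<_ (x ∷ ys) →
                       ∃[ z ] Chain _<_ (_∈[ h ]A) (h · x) z (length ys * h)
    increasing⇒chain {h} {x} {[]}     ⊆A _           = h · x , [ ·-∈[]A h (⊆A (here refl)) ]
    increasing⇒chain     {ys = _ ∷ _} ⊆A (x<y ∷ inc) =
      map₂ (segment (⊆A (here refl)) (⊆A (there (here refl))) x<y ++_) (increasing⇒chain (⊆A ∘ there) inc)

    -- h·y < x + z + (h − 2)·y < z + (h − 1)·y < x + 2z + (h − 3)·y < 2z + (h − 2)·y:
    -- two more steps than the segments x → y → z.
    bent-triple : ∀ {n x y z} → x ∈ elements → y ∈ elements → z ∈ elements →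
                  x < y → y < z → y ∙ y < x ∙ z →
                  Chain _<_ (_∈[ 3 + n ]A) ((3 + n) · x) ((3 + n) · z) (2 * (3 + n) + 2)
    bent-triple {n} {x} {y} {z} x∈ y∈ z∈ x<y y<z yy<xz = cast (length-identity n) (
      segment x∈ y∈ x<y ++
        (·-∈[]A (3 + n) y∈
          ∷⟨ <-respˡ-≈ (assoc y y (y ∙ N)) (+-mono-< (y ∙ N) yy<xz) ⟩
         ∙-∈[+]A (∙-∈[+]A x∈₁ z∈₁) (·-∈[]A (suc n) y∈)
          ∷⟨ +-mono-< (y ∙ N) (+-mono-< z x<y) ⟩
         ∙-∈[+]A (∙-∈[+]A y∈₁ z∈₁) (·-∈[]A (suc n) y∈)
          ∷⟨ <-respˡ-≈ (interchange y y z N) (+-mono-< (z ∙ N) yy<xz) ⟩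
         ∙-∈[+]A (∙-∈[+]A x∈₁ z∈₁) (∙-∈[+]A z∈₁ (·-∈[]A n y∈))
          ∷⟨ <-respʳ-≈ (trans (∙-cong (comm y z) refl) (interchange z y z N)) (+-mono-< (z ∙ N) (+-mono-< z x<y)) ⟩
         chain-respʳ ∈[]A-resp (assoc z z (suc n · z))
           (translated-segment y∈ z∈ y<z (∙-∈[+]A z∈₁ z∈₁) ≡.refl)))
      where
      length-identity : ∀ n → (3 + n) + (4 + suc n) ≡ 2 * (3 + n) + 2
      length-identity = solve-∀
      N : Carrier
      N = n · y
      x∈₁ : x ∈[ 1 ]A
      x∈₁ = ∈⇒∈[1]A x∈
      y∈₁ : y ∈[ 1 ]A
      y∈₁ = ∈⇒∈[1]A y∈
      z∈₁ : z ∈[ 1 ]A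
      z∈₁ = ∈⇒∈[1]A z∈

    elements-unique : Distinct G A → Unique elements
    elements-unique distinct = Uniqueₛ.tabulate⁺ setoid (λ {i} {j} → distinct i j)

    progression-sum : ∀ {K a d} → (∀ j → ∃[ t ] t ≤ K × lookup A j ≈ a ∙ t · d) →
                      ∀ {h} (f : Vec (Fin k) h) → ∃[ T ] T ≤ h * K × sumᴳ G (Vec.map (lookup A) f) ≈ h · a ∙ T · d
    progression-sum _ [] = 0 , z≤n , sym (identityʳ ε)
    progression-sum {a = a} {d} A⊆ {suc h} (i ∷ f) =
      let (t , t≤K , Aᵢ≈) = A⊆ i ; (T , T≤hK , σf≈) = progression-sum A⊆ f in
      t + T , ℕₚ.+-mono-≤ t≤K T≤hK ,
      trans (∙-cong Aᵢ≈ σf≈) (trans (interchange a (t · d) (h · a) (T · d)) (∙-cong refl (sym (×-homo-+ d t T))))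

    progression⇒size≤ : ∀ {h K a d m} → (∀ j → ∃[ t ] t ≤ K × lookup A j ≈ a ∙ t · d) →
                        HasSize G (_∈[ h ]A) m → m ≤ h * K + 1
    progression⇒size≤ {h} {K} {a} {d} {m} A⊆ hasSize =
      ≡.subst (m ≤_) (ℕₚ.+-comm 1 (h * K)) (cover⇒size≤ (λ i → h · a ∙ toℕ i · d) covers hasSize)
      where
      covers : ∀ x → x ∈[ h ]A → ∃[ i ] x ≈ h · a ∙ toℕ i · d
      covers x (f , x≈σf) =
        let (T , T≤hK , σf≈) = progression-sum A⊆ f in
        Fin.fromℕ< (s≤s T≤hK) , trans x≈σf (trans σf≈ (∙-cong refl (×-congˡ {d} (≡.sym (Finₚ.toℕ-fromℕ< (s≤s T≤hK))))))

    increasing⇒size> : ∀ {h m x ys} → x ∷ ys ⊆ elements → Linked _<_ (x ∷ ys) →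
                       HasSize G (_∈[ h ]A) m → h * length ys ℕ.< m
    increasing⇒size> {h} {m} {ys = ys} ⊆A increasing hasSize =
      ≡.subst (ℕ._< m) (ℕₚ.*-comm (length ys) h) (chain⇒<size (proj₂ (increasing⇒chain ⊆A increasing)) hasSize)

  module _ {K} (A : Vec Carrier (suc K)) (distinct : Distinct G A) where
    open Sumset A

    sorted-elements : ∃[ x ] ∃[ xs ] Linked _<_ (x ∷ xs) × x ∷ xs ⊆ elements × elements ⊆ x ∷ xs × length xs ≡ K
    sorted-elements with increasing-permutation (elements-unique distinct)
    ... | [] , _ , []↭elements =
      ⊥-elim (ℕₚ.0≢1+n (≡.trans (↭ₚ.xs↭ys⇒|xs|≡|ys| []↭elements) (Listₚ.length-tabulate (lookup A))))
    ... | x ∷ xs , increasing , sorted↭elements =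
      x , xs , increasing , ↭ₚ.∈-resp-↭ sorted↭elements , ↭ₚ.∈-resp-↭ (↭-sym sorted↭elements) ,
      ℕₚ.suc-injective (≡.trans (↭ₚ.xs↭ys⇒|xs|≡|ys| sorted↭elements) (Listₚ.length-tabulate (lookup A)))

    sumset-size≥ : ∀ {h m} → HasSize G (_∈[ h ]A) m → h * K + 1 ≤ m
    sumset-size≥ {h} {m} hasSize with sorted-elements
    ... | _ , _ , increasing , sorted⊆A , _ , ≡.refl =
      ≡.subst (_≤ m) (ℕₚ.+-comm 1 (h * K)) (increasing⇒size> sorted⊆A increasing hasSize)

module SumsetSize {c ℓ ℓ<} (G : OrderedAbelianGroup c ℓ ℓ<) where

  open OrderedAbelianGroup G
  open OrderedGroup G

  module _ {k} (A : Vec Carrier k) where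
    open Sumset A

    nonArithmetic-triple : ∀ {n x y z} → x ∈ elements → y ∈ elements → z ∈ elements →
                           x < y → y < z → ¬ x ∙ z ≈ y ∙ y →
                           Chain _<_ (_∈[ 3 + n ]A) ((3 + n) · x) ((3 + n) · z) (2 * (3 + n) + 2)
    nonArithmetic-triple {x = x} {y} {z} x∈ y∈ z∈ x<y y<z xz≉yy with compare (y ∙ y) (x ∙ z)
    ... | tri< yy<xz _ _ = bent-triple x∈ y∈ z∈ x<y y<z yy<xz
    ... | tri≈ _ yy≈xz _ = ⊥-elim (xz≉yy (sym yy≈xz))
    ... | tri> _ _ xz<yy =
      reverse (OrderedGroup.Sumset.bent-triple (opposite G) A z∈ y∈ x∈ y<z x<y (<-respˡ-≈ (comm x z) xz<yy))

    nonArithmetic⇒chain : ∀ {n x ys} → NonArithmetic (x ∷ ys) → x ∷ ys ⊆ elements → Linked _<_ (x ∷ ys) →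
                          ∃[ z ] Chain _<_ (_∈[ 3 + n ]A) ((3 + n) · x) z (length ys * (3 + n) + 2)
    nonArithmetic⇒chain {n} {ys = _ ∷ _ ∷ zs} (here xz≉yy) ⊆A (x<y ∷ y<z ∷ increasing) =
      map₂ (λ chain → cast (length-identity (3 + n) (length zs))
                        (nonArithmetic-triple (⊆A (here refl)) (⊆A (there (here refl))) (⊆A (there (there (here refl))))
                                              x<y y<z xz≉yy ++ chain))
           (increasing⇒chain (λ z∈ → ⊆A (there (there z∈))) increasing)
      where
      length-identity : ∀ h L → 2 * h + 2 + L * h ≡ (2 + L) * h + 2
      length-identity = solve-∀
    nonArithmetic⇒chain {n} (there nonArithmetic) ⊆A (x<y ∷ increasing) =
      map₂ (λ chain → cast (≡.sym (ℕₚ.+-assoc (3 + n) _ 2)) (segment (⊆A (here refl)) (⊆A (there (here refl))) x<y ++ chain))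
           (nonArithmetic⇒chain nonArithmetic (λ y∈ → ⊆A (there y∈)) increasing)

    nonArithmetic⇒size> : ∀ {n m x ys} → NonArithmetic (x ∷ ys) → x ∷ ys ⊆ elements → Linked _<_ (x ∷ ys) →
                          HasSize G (_∈[ 3 + n ]A) m → (3 + n) * length ys + 2 ℕ.< m
    nonArithmetic⇒size> {n} {m} {ys = ys} nonArithmetic ⊆A increasing hasSize =
      ≡.subst (λ L → L + 2 ℕ.< m) (ℕₚ.*-comm (length ys) (3 + n))
        (chain⇒<size (proj₂ (nonArithmetic⇒chain nonArithmetic ⊆A increasing)) hasSize)

  module _ {K} (A : Vec Carrier (suc K)) (distinct : Distinct G A) where
    open Sumset A

    sumset-size-gap : ∀ {n m} → HasSize G (_∈[ 3 + n ]A) m → m ≤ (3 + n) * K + 1 ⊎ (3 + n) * K + 2 ℕ.< m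
    sumset-size-gap {n} {m} hasSize with sorted-elements A distinct
    ... | x , xs , increasing , sorted⊆A , A⊆sorted , ≡.refl with arithmetic-or-nonArithmetic (x ∷ xs)
    ...   | inj₁ (d , progression) =
      inj₁ (progression⇒size≤ A-in-progression hasSize)
      where
      A-in-progression : ∀ j → ∃[ t ] t ≤ length xs × lookup A j ≈ x ∙ t · d
      A-in-progression j = arithmetic-∈ progression (A⊆sorted (∈ₛ.∈-tabulate⁺ setoid {f = lookup A} j))
    ...   | inj₂ nonArithmetic = inj₂ (nonArithmetic⇒size> A nonArithmetic sorted⊆A increasing hasSize)

  module Examples {g} (ε<g : ε < g) where

    multiples : ∀ {k} → (Fin k → ℕ) → Vec Carrier k
    multiples φ = Vec.tabulate (λ i → φ i · g)

    module _ {k} (φ : Fin k → ℕ) (φ-increasing : ∀ {i j} → i Fin.< j → φ i ℕ.< φ j) where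
      open Sumset (multiples φ)

      multiples-increasing : ∀ {i j} → i Fin.< j → lookup (multiples φ) i < lookup (multiples φ) j
      multiples-increasing {i} {j} i<j =
        <-resp₂ (reflexive (≡.sym (Vecₚ.lookup∘tabulate _ i))) (reflexive (≡.sym (Vecₚ.lookup∘tabulate _ j)))
          (·-strictMonoˡ ε<g (φ-increasing i<j))

      multiples-distinct : Distinct G (multiples φ)
      multiples-distinct = strictMono⇒injective multiples-increasing

      elements-increasing : Linked _<_ elements
      elements-increasing = AllPairs⇒Linked (AllPairsₚ.tabulate⁺-< multiples-increasing)

    progression-sumset : ∀ h K → InR G h (suc K) (h * K + 1)
    progression-sumset h K with Sumset.sumset-hasSize (multiples toℕ) h
    ... | m , hasSize = multiples toℕ , distinct , ≡.subst (HasSize G _) (ℕₚ.≤-antisym upper lower) hasSize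
      where
      distinct : Distinct G (multiples {suc K} toℕ)
      distinct = multiples-distinct toℕ (λ i<j → i<j)
      A-progression : ∀ j → ∃[ t ] t ≤ K × lookup (multiples toℕ) j ≈ ε ∙ t · g
      A-progression j = toℕ j , Finₚ.toℕ≤pred[n] j , trans (reflexive (Vecₚ.lookup∘tabulate (λ i → toℕ i · g) j)) (sym (identityˡ _))
      upper : m ≤ h * K + 1
      upper = Sumset.progression⇒size≤ (multiples toℕ) A-progression hasSize
      lower : h * K + 1 ≤ m
      lower = sumset-size≥ (multiples toℕ) distinct hasSize

    gapped : ∀ {k} → Fin (suc k) → ℕ
    gapped zero    = 0
    gapped (suc i) = 2 + toℕ i

    gapped-increasing : ∀ {k} {i j : Fin (suc k)} → i Fin.< j → gapped i ℕ.< gapped j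
    gapped-increasing {i = zero}  {suc j} _         = s≤s z≤n
    gapped-increasing {i = suc i} {suc j} (s≤s i<j) = s≤s (s≤s i<j)

    nonprogression-sumset : ∀ n K → 2 ≤ K → ∃[ m ] (3 + n) * K + 2 ℕ.< m × InR G (3 + n) (suc K) m
    nonprogression-sumset n (suc zero) (s≤s ())
    nonprogression-sumset n (suc (suc K)) _ with Sumset.sumset-hasSize (multiples gapped) (3 + n)
    ... | m , hasSize =
      m , ≡.subst (λ L → (3 + n) * L + 2 ℕ.< m) (Listₚ.length-tabulate {n = 2 + K} (lookup (multiples gapped) ∘ suc))
            (nonArithmetic⇒size> (multiples gapped) (here 3g≉2g+2g) (λ x∈ → x∈)
              (elements-increasing gapped gapped-increasing) hasSize) ,
      multiples gapped , multiples-distinct gapped gapped-increasing , hasSize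
      where
      3g≉2g+2g : ¬ ε ∙ 3 · g ≈ 2 · g ∙ 2 · g
      3g≉2g+2g ε∙3g≈2g∙2g =
        irrefl (trans (sym (identityˡ _)) (trans ε∙3g≈2g∙2g (sym (×-homo-+ g 2 2)))) (·-strictMonoˡ ε<g (ℕₚ.n<1+n 3))

  R-minimum : Nontrivial G → ∀ h K → InR G h (suc K) (h * K + 1)
  R-minimum nontrivial = Examples.progression-sumset (proj₂ (positive-element nontrivial))

  R-lower-bound : ∀ {h K m} → InR G h (suc K) m → h * K + 1 ≤ m
  R-lower-bound (A , distinct , hasSize) = sumset-size≥ A distinct hasSize

  R-gap : ∀ {h K} → 3 ≤ h → ¬ InR G h (suc K) (h * K + 2)
  R-gap {h} {K} (s≤s (s≤s (s≤s z≤n))) (A , distinct , hasSize) with sumset-size-gap A distinct hasSize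
  ... | inj₁ +2≤+1 = ℕₚ.≤⇒≯ +2≤+1 (ℕₚ.+-monoʳ-< (h * K) (ℕₚ.n<1+n 1))
  ... | inj₂ +2<+2 = ℕₚ.<-irrefl ≡.refl +2<+2

  R-not-interval : Nontrivial G → ∀ {h K} → 3 ≤ h → 2 ≤ K → ¬ IsIntervalℕ (InR G h (suc K))
  R-not-interval nontrivial {h@(suc (suc (suc n)))} {K} 3≤h@(s≤s (s≤s (s≤s z≤n))) 2≤K interval =
    let (m , +2<m , inR) = nonprogression-sumset n K 2≤K in
    R-gap 3≤h (interval _ _ m (ℕₚ.+-monoʳ-< (h * K) (ℕₚ.n<1+n 1)) +2<m (progression-sumset h K) inR)
    where open Examples (proj₂ (positive-element nontrivial))

theorem7 : ∀ {c ℓ ℓ< : Level} (G : OrderedAbelianGroup c ℓ ℓ<) → Nontrivial G →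
    ∀ (h k : ℕ) → 3 ≤ h → 3 ≤ k →
      (InR G h k (h * k ∸ h + 1) × (∀ m → InR G h k m → h * k ∸ h + 1 ≤ m))
      × ¬ InR G h k (h * k ∸ h + 2)
      × ¬ IsIntervalℕ (InR G h k)
theorem7 G nontrivial h (suc K) 3≤h (s≤s 2≤K) rewrite ℕₚ.*-suc h K | ℕₚ.m+n∸m≡n h (h * K) =
  (R-minimum nontrivial h K , λ _ → R-lower-bound) , R-gap 3≤h , R-not-interval nontrivial 3≤h 2≤K
  where open SumsetSize G
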